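{- For every finite set $\Gamma$ of formulas of intuitionistic propositional logic and every such formula $\phi$: $\Gamma \Vdash^{\ast} \phi$ if and only if $\Gamma \vdash \phi$ in intuitionistic propositional logic (IPL).
   Context: Fix a denumerable set $\mathbb{A}$ of atoms. IPL formulas are built from atoms and $\bot$ using $\land,\lor,\to$. An atomic rule has the form $(Q_1\triangleright q_1,\dots,Q_n\triangleright q_n)\Rightarrow q$ with $n\ge 0$, $q,q_i$ atoms and $Q_i$ finite (possibly empty) sets of atoms. A base is a set of atomic rules; $\mathscr{C}\supseteq\mathscr{B}$ means $\mathscr{C}$ extends $\mathscr{B}$. Derivability in a base $\mathscr{B}$ (for finite sets of atoms $S$) is the least relation with: $S\cup\{q\}\vdash_{\mathscr B} q$; and if $(Q_1\triangleright q_1,\dots,Q_n\triangleright q_n)\Rightarrow q\in\mathscr B$ and $S\cup Q_i\vdash_{\mathscr B} q_i$ for all $i$, then $S\vdash_{\mathscr B} q$. The relation $\Vdash^{\ast}_{\mathscr B}$ is defined by: $\Vdash^{\ast}_{\mathscr B} p$ iff $\emptyset\vdash_{\mathscr B} p$ (for atoms $p$); $\Vdash^{\ast}_{\mathscr B}\phi\to\psi$ iff $\phi\Vdash^{\ast}_{\mathscr B}\psi$; $\Vdash^{\ast}_{\mathscr B}\phi\land\psi$ iff for every $\mathscr C\supseteq\mathscr B$ and every atom $p$, if $\phi,\psi\Vdash^{\ast}_{\mathscr C} p$ then $\Vdash^{\ast}_{\mathscr C} p$; $\Vdash^{\ast}_{\mathscr B}\phi\lor\psi$ iff for every $\mathscr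 C\supseteq\mathscr B$ and every atom $p$, if $\phi\Vdash^{\ast}_{\mathscr C}p$ and $\psi\Vdash^{\ast}_{\mathscr C}p$ then $\Vdash^{\ast}_{\mathscr C}p$; $\Vdash^{\ast}_{\mathscr B}\bot$ iff $\Vdash^{\ast}_{\mathscr B}p$ for every atom $p$; for nonempty finite $\Gamma$, $\Gamma\Vdash^{\ast}_{\mathscr B}\phi$ iff for every $\mathscr C\supseteq\mathscr B$, if $\Vdash^{\ast}_{\mathscr C}\psi$ for all $\psi\in\Gamma$ then $\Vdash^{\ast}_{\mathscr C}\phi$ (for empty $\Gamma$ it means $\Vdash^{\ast}_{\mathscr B}\phi$). Finally $\Gamma\Vdash^{\ast}\phi$ iff $\Gamma\Vdash^{\ast}_{\mathscr B}\phi$ for every base $\mathscr B$. -}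

module Defs where

open import Data.Nat using (ℕ)
open import Data.List using (List; []; _∷_; _++_)
open import Data.List.Membership.Propositional using (_∈_)
open import Data.List.Relation.Unary.All using (All)
open import Data.Product using (_×_; _,_)
open import Level using (Level; Lift; suc; zero)

Atom : Set
Atom = ℕ

infixr 5 _⇒_
infixr 6 _∨ᶠ_
infixr 7 _∧ᶠ_
data Formula : Set where
  atom : Atom → Formula
  ⊥ᶠ   : Formula
  _∧ᶠ_ : Formula → Formula → Formula
  _∨ᶠ_ : Formula → Formula → Formula
  _⇒_  : Formula → Formula → Formula

-- Atomic rule (Q₁ ▷ q₁, …, Qₙ ▷ qₙ) ⇒ q; finite sets of atoms are lists.
record Rule : Set where
  constructor _⟹_
  field
    premises   : List (List Atom × Atom)
    conclusion : Atom
open Rule public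

Base : Set₁
Base = Rule → Set

_⊆ᴮ_ : Base → Base → Set
B ⊆ᴮ C = ∀ r → B r → C r

-- Derivability S ⊢_B q in a base (S a finite set of atoms, S ∪ Q as S ++ Q).
data _⊢[_]_ (S : List Atom) (B : Base) : Atom → Set where
  ref  : ∀ {q} → q ∈ S → S ⊢[ B ] q
  app  : ∀ {r} → B r →
         (∀ {Q q} → (Q , q) ∈ premises r → (S ++ Q) ⊢[ B ] q) →
         S ⊢[ B ] conclusion r

⊩ : Base → Formula → Set₁
⊩ B (atom p) = Lift (suc zero) ([] ⊢[ B ] p)
⊩ B ⊥ᶠ = ∀ p → ⊩ B (atom p)
-- φ ⊩_B ψ  (singleton, nonempty context)
⊩ B (φ ⇒ ψ) = ∀ C → B ⊆ᴮ C → ⊩ C φ → ⊩ C ψ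
-- φ, ψ ⊩_C p  ⇒  ⊩_C p
⊩ B (φ ∧ᶠ ψ) = ∀ C → B ⊆ᴮ C → ∀ p →
  (∀ D → C ⊆ᴮ D → ⊩ D φ → ⊩ D ψ → ⊩ D (atom p)) → ⊩ C (atom p)
-- φ ⊩_C p and ψ ⊩_C p  ⇒  ⊩_C p
⊩ B (φ ∨ᶠ ψ) = ∀ C → B ⊆ᴮ C → ∀ p →
  (∀ D → C ⊆ᴮ D → ⊩ D φ → ⊩ D (atom p)) →
  (∀ D → C ⊆ᴮ D → ⊩ D ψ → ⊩ D (atom p)) → ⊩ C (atom p)

_⊩[_]_ : List Formula → Base → Formula → Set₁
[] ⊩[ B ] φ = ⊩ B φ
(γ ∷ Γ) ⊩[ B ] φ = ∀ C → B ⊆ᴮ C → All (⊩ C) (γ ∷ Γ) → ⊩ C φ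

_⊩*_ : List Formula → Formula → Set₁
Γ ⊩* φ = ∀ B → Γ ⊩[ B ] φ

infix 3 _⊢_
data _⊢_ (Γ : List Formula) : Formula → Set where
  hyp  : ∀ {φ} → φ ∈ Γ → Γ ⊢ φ
  ⊥E   : ∀ {φ} → Γ ⊢ ⊥ᶠ → Γ ⊢ φ
  ∧I   : ∀ {φ ψ} → Γ ⊢ φ → Γ ⊢ ψ → Γ ⊢ φ ∧ᶠ ψ
  ∧E₁  : ∀ {φ ψ} → Γ ⊢ φ ∧ᶠ ψ → Γ ⊢ φ
  ∧E₂  : ∀ {φ ψ} → Γ ⊢ φ ∧ᶠ ψ → Γ ⊢ ψ
  ∨I₁  : ∀ {φ ψ} → Γ ⊢ φ → Γ ⊢ φ ∨ᶠ ψ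
  ∨I₂  : ∀ {φ ψ} → Γ ⊢ ψ → Γ ⊢ φ ∨ᶠ ψ
  ∨E   : ∀ {φ ψ χ} → Γ ⊢ φ ∨ᶠ ψ → (φ ∷ Γ) ⊢ χ → (ψ ∷ Γ) ⊢ χ → Γ ⊢ χ
  ⇒I   : ∀ {φ ψ} → (φ ∷ Γ) ⊢ ψ → Γ ⊢ φ ⇒ ψ
  ⇒E   : ∀ {φ ψ} → Γ ⊢ φ ⇒ ψ → Γ ⊢ φ → Γ ⊢ ψ

-- For completeness
-- (Sandqvist's argument) give every non-atomic subformula χ of Γ and φ a fresh
-- atom ♭χ, and let the base 𝒩 contain the atomic rules that mimic the natural
-- deduction rules on these atoms. In every extension of 𝒩, ♭χ is supported
-- exactly when χ is. Hence Γ ⊩* φ, instantiated at 𝒩 extended by the axioms ♭γ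
-- (γ ∈ Γ), yields an atomic derivation of ♭φ, and reading every atom ♭χ back
-- as χ turns it into a natural deduction derivation of Γ ⊢ φ.
module Submission where

open import Defs
open import Data.Empty using (⊥-elim)
open import Data.List using (List; []; _∷_; _++_; map; foldr)
open import Data.List.Membership.Propositional using (_∈_)
open import Data.List.Membership.Propositional.Properties using (∈-++⁺ˡ; ∈-++⁺ʳ; ∈-++⁻; ∈-map⁺; ∈-map⁻)
open import Data.List.Relation.Binary.Subset.Propositional using (_⊆_)
open import Data.List.Relation.Binary.Subset.Propositional.Properties using (⊆-refl; ++⁺ˡ)
open import Data.List.Relation.Unary.All as All using (All; []; _∷_)
open import Data.List.Relation.Unary.Any using (here; there)
open import Data.Nat using (ℕ; zero; suc; _+_; _∸_; _⊔_; _≤_; _<_; z≤n; s≤s; _<?_)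
open import Data.Nat.Properties
  using (≤-refl; ≤-trans; ≤-<-trans; <-≤-trans; m≤m+n; m≤n+m; m≤n⇒m≤1+n; +-suc; +-identityʳ
        ; n∸n≡0; +-∸-assoc; m+n∸n≡m; m+n∸m≡n; m+n≮m; m⊔n≤o⇒m≤o; m⊔n≤o⇒n≤o)
open import Data.Product using (_×_; _,_; proj₁; proj₂)
open import Data.Sum using (_⊎_; inj₁; inj₂)
open import Level using (lift; lower)
open import Relation.Binary.PropositionalEquality using (_≡_; refl; sym; trans; cong; subst; module ≡-Reasoning)
open import Relation.Nullary using (yes; no)

⊆ᴮ-refl : ∀ {B} → B ⊆ᴮ B
⊆ᴮ-refl _ r = r

⊆ᴮ-trans : ∀ {B C D} → B ⊆ᴮ C → C ⊆ᴮ D → B ⊆ᴮ D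
⊆ᴮ-trans B⊆C C⊆D r r∈B = C⊆D r (B⊆C r r∈B)

⊢-mono : ∀ {B C S q} → B ⊆ᴮ C → S ⊢[ B ] q → S ⊢[ C ] q
⊢-mono B⊆C (ref q∈S)       = ref q∈S
⊢-mono B⊆C (app {r} r∈B ds) = app (B⊆C r r∈B) (λ m → ⊢-mono B⊆C (ds m))

⊩-mono : ∀ {φ B C} → B ⊆ᴮ C → ⊩ B φ → ⊩ C φ
⊩-mono {atom p}   B⊆C (lift d) = lift (⊢-mono B⊆C d)
⊩-mono {⊥ᶠ}       B⊆C s p      = ⊩-mono B⊆C (s p)
⊩-mono {φ ∧ᶠ ψ}   B⊆C s D C⊆D  = s D (⊆ᴮ-trans B⊆C C⊆D)
⊩-mono {φ ∨ᶠ ψ}   B⊆C s D C⊆D  = s D (⊆ᴮ-trans B⊆C C⊆D)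
⊩-mono {φ ⇒ ψ}    B⊆C s D C⊆D  = s D (⊆ᴮ-trans B⊆C C⊆D)

⊩[]-apply : ∀ Γ {φ B C} → Γ ⊩[ B ] φ → B ⊆ᴮ C → All (⊩ C) Γ → ⊩ C φ
⊩[]-apply []      s B⊆C _  = ⊩-mono B⊆C s
⊩[]-apply (_ ∷ _) s B⊆C Γs = s _ B⊆C Γs

⊥⇒⊩ : ∀ φ {B} → ⊩ B ⊥ᶠ → ⊩ B φ
⊥⇒⊩ (atom p) s = s p
⊥⇒⊩ ⊥ᶠ       s = s
⊥⇒⊩ (φ ∧ᶠ ψ) s C B⊆C p _   = ⊩-mono B⊆C (s p)
⊥⇒⊩ (φ ∨ᶠ ψ) s C B⊆C p _ _ = ⊩-mono B⊆C (s p)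
⊥⇒⊩ (φ ⇒ ψ)  s C B⊆C _     = ⊥⇒⊩ ψ (λ p → ⊩-mono B⊆C (s p))

-- The shape of the ∧ and ∨ clauses of ⊩, for a single formula.
AtomicElim : Base → Formula → Set₁
AtomicElim B φ = ∀ C → B ⊆ᴮ C → ∀ p → (∀ D → C ⊆ᴮ D → ⊩ D φ → ⊩ D (atom p)) → ⊩ C (atom p)

atomicElim⇒⊩ : ∀ φ {B} → AtomicElim B φ → ⊩ B φ
atomicElim⇒⊩ (atom q) e = e _ ⊆ᴮ-refl q (λ _ _ s → s)
atomicElim⇒⊩ ⊥ᶠ       e p = e _ ⊆ᴮ-refl p (λ _ _ s → s p)
atomicElim⇒⊩ (φ ∧ᶠ ψ) e C B⊆C p k =
  e C B⊆C p (λ D C⊆D s → s D ⊆ᴮ-refl p (λ E D⊆E → k E (⊆ᴮ-trans C⊆D D⊆E)))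
atomicElim⇒⊩ (φ ∨ᶠ ψ) e C B⊆C p k₁ k₂ =
  e C B⊆C p (λ D C⊆D s → s D ⊆ᴮ-refl p (λ E D⊆E → k₁ E (⊆ᴮ-trans C⊆D D⊆E))
                                        (λ E D⊆E → k₂ E (⊆ᴮ-trans C⊆D D⊆E)))
atomicElim⇒⊩ (φ ⇒ ψ)  e C B⊆C sφ = atomicElim⇒⊩ ψ λ D C⊆D p k →
  e D (⊆ᴮ-trans B⊆C C⊆D) p (λ E D⊆E s → k E D⊆E (s E ⊆ᴮ-refl (⊩-mono (⊆ᴮ-trans C⊆D D⊆E) sφ)))

sound : ∀ {Γ φ} → Γ ⊢ φ → ∀ B → All (⊩ B) Γ → ⊩ B φ
sound (hyp φ∈Γ) B Γs = All.lookup Γs φ∈Γ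
sound (⊥E d)    B Γs = ⊥⇒⊩ _ (sound d B Γs)
sound (∧I d e)  B Γs C B⊆C p k = k C ⊆ᴮ-refl (⊩-mono B⊆C (sound d B Γs)) (⊩-mono B⊆C (sound e B Γs))
sound (∧E₁ {φ} d) B Γs = atomicElim⇒⊩ φ λ C B⊆C p k → sound d B Γs C B⊆C p (λ D C⊆D sφ _ → k D C⊆D sφ)
sound (∧E₂ {ψ = ψ} d) B Γs = atomicElim⇒⊩ ψ λ C B⊆C p k → sound d B Γs C B⊆C p (λ D C⊆D _ sψ → k D C⊆D sψ)
sound (∨I₁ d)   B Γs C B⊆C p k₁ _ = k₁ C ⊆ᴮ-refl (⊩-mono B⊆C (sound d B Γs))
sound (∨I₂ d)   B Γs C B⊆C p _ k₂ = k₂ C ⊆ᴮ-refl (⊩-mono B⊆C (sound d B Γs))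
sound (∨E {χ = χ} d e f) B Γs = atomicElim⇒⊩ χ λ C B⊆C p k → sound d B Γs C B⊆C p
  (λ D C⊆D sφ → k D C⊆D (sound e D (sφ ∷ All.map (⊩-mono (⊆ᴮ-trans B⊆C C⊆D)) Γs)))
  (λ D C⊆D sψ → k D C⊆D (sound f D (sψ ∷ All.map (⊩-mono (⊆ᴮ-trans B⊆C C⊆D)) Γs)))
sound (⇒I d)    B Γs C B⊆C sφ = sound d C (sφ ∷ All.map (⊩-mono B⊆C) Γs)
sound (⇒E d e)  B Γs = sound d B Γs B ⊆ᴮ-refl (sound e B Γs)

soundness : ∀ Γ φ → Γ ⊢ φ → Γ ⊩* φ
soundness []      φ d B          = sound d B []
soundness (_ ∷ _) φ d B C _ Γs   = sound d C Γs

data Ax (S : List Atom) : Rule → Set where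
  ax : ∀ {s} → s ∈ S → Ax S ([] ⟹ s)

_∪ax_ : Base → List Atom → Base
(B ∪ax S) r = B r ⊎ Ax S r

∪ax-⊇ : ∀ {B S} → B ⊆ᴮ (B ∪ax S)
∪ax-⊇ _ = inj₁

axiom : ∀ {B S s} → s ∈ S → [] ⊢[ B ∪ax S ] s
axiom s∈S = app (inj₂ (ax s∈S)) (λ ())

⊩-rule₁ : ∀ {B q c} → B ((([] , q) ∷ []) ⟹ c) → ⊩ B (atom q) → ⊩ B (atom c)
⊩-rule₁ r (lift d) = lift (app r λ { (here refl) → d ; (there ()) })

⊩-rule₂ : ∀ {B q₁ q₂ c} → B ((([] , q₁) ∷ ([] , q₂) ∷ []) ⟹ c) →
          ⊩ B (atom q₁) → ⊩ B (atom q₂) → ⊩ B (atom c)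
⊩-rule₂ r (lift d₁) (lift d₂) =
  lift (app r λ { (here refl) → d₁ ; (there (here refl)) → d₂ ; (there (there ())) })

axioms⇒hypotheses : ∀ {B S S′ T q} → S′ ⊆ T → S ⊆ T → S′ ⊢[ B ∪ax S ] q → T ⊢[ B ] q
axioms⇒hypotheses S′⊆T S⊆T (ref q∈S′)             = ref (S′⊆T q∈S′)
axioms⇒hypotheses S′⊆T S⊆T (app (inj₁ r∈B) ds)    =
  app r∈B (λ {Q} m → axioms⇒hypotheses (++⁺ˡ Q S′⊆T) (λ s∈S → ∈-++⁺ˡ (S⊆T s∈S)) (ds m))
axioms⇒hypotheses S′⊆T S⊆T (app (inj₂ (ax s∈S)) _) = ref (S⊆T s∈S)

tri : ℕ → ℕ
tri zero    = zero
tri (suc n) = tri n + suc n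

-- Cantor pairing: pair a b is the position of (a , b) when ℕ × ℕ is enumerated
-- along the antidiagonals, and unpair walks that enumeration.
pair : ℕ → ℕ → ℕ
pair a b = tri (a + b) + b

step : ℕ × ℕ → ℕ × ℕ
step (zero  , b) = suc b , zero
step (suc a , b) = a , suc b

unpair : ℕ → ℕ × ℕ
unpair zero    = zero , zero
unpair (suc n) = step (unpair n)

unpair-tri+ : ∀ s b → b ≤ s → unpair (tri s + b) ≡ (s ∸ b , b)
unpair-tri+ zero    zero    _ = refl
unpair-tri+ (suc s) zero    _ = begin
  unpair (tri s + suc s + 0)  ≡⟨ cong unpair (trans (+-identityʳ _) (+-suc (tri s) s)) ⟩
  step (unpair (tri s + s))   ≡⟨ cong step (unpair-tri+ s s ≤-refl) ⟩
  step (s ∸ s , s)            ≡⟨ cong (λ a → step (a , s)) (n∸n≡0 s) ⟩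
  (suc s , 0)                 ∎
  where open ≡-Reasoning
unpair-tri+ (suc s) (suc b) (s≤s b≤s) = begin
  unpair (tri (suc s) + suc b)     ≡⟨ cong unpair (+-suc (tri (suc s)) b) ⟩
  step (unpair (tri (suc s) + b))  ≡⟨ cong step (unpair-tri+ (suc s) b (m≤n⇒m≤1+n b≤s)) ⟩
  step (suc s ∸ b , b)             ≡⟨ cong (λ a → step (a , b)) (+-∸-assoc 1 b≤s) ⟩
  (s ∸ b , suc b)                  ∎
  where open ≡-Reasoning

unpair-pair : ∀ a b → unpair (pair a b) ≡ (a , b)
unpair-pair a b = trans (unpair-tri+ (a + b) b (m≤n+m b a)) (cong (_, b) (m+n∸n≡m a b))

n≤tri[n] : ∀ n → n ≤ tri n
n≤tri[n] zero    = z≤n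
n≤tri[n] (suc n) = m≤n+m (suc n) (tri n)

a≤pair[a,b] : ∀ a b → a ≤ pair a b
a≤pair[a,b] a b = ≤-trans (m≤m+n a b) (≤-trans (n≤tri[n] (a + b)) (m≤m+n (tri (a + b)) b))

b≤pair[a,b] : ∀ a b → b ≤ pair a b
b≤pair[a,b] a b = m≤n+m b (tri (a + b))

b<pair[1+a,b] : ∀ a b → b < pair (suc a) b
b<pair[1+a,b] a b =
  ≤-trans (s≤s (m≤n+m b a)) (≤-trans (n≤tri[n] (suc a + b)) (m≤m+n (tri (suc a + b)) b))

encode : Formula → ℕ
encode (atom p) = pair 0 p
encode ⊥ᶠ       = pair 1 0
encode (a ∧ᶠ b) = pair 2 (pair (encode a) (encode b))
encode (a ∨ᶠ b) = pair 3 (pair (encode a) (encode b))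
encode (a ⇒ b)  = pair 4 (pair (encode a) (encode b))

encode-<ˡ : ∀ t a b → a < pair (suc t) (pair a b)
encode-<ˡ t a b = ≤-<-trans (a≤pair[a,b] a b) (b<pair[1+a,b] t (pair a b))

encode-<ʳ : ∀ t a b → b < pair (suc t) (pair a b)
encode-<ʳ t a b = ≤-<-trans (b≤pair[a,b] a b) (b<pair[1+a,b] t (pair a b))

-- The first argument is fuel.
decodeWith : ℕ → ℕ → Formula
decodeNode : ℕ → ℕ × ℕ → Formula
decodeWith zero    _ = ⊥ᶠ
decodeWith (suc f) n = decodeNode f (unpair n)
decodeNode f (0 , p) = atom p
decodeNode f (2 , r) = decodeWith f (proj₁ (unpair r)) ∧ᶠ decodeWith f (proj₂ (unpair r))
decodeNode f (3 , r) = decodeWith f (proj₁ (unpair r)) ∨ᶠ decodeWith f (proj₂ (unpair r))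
decodeNode f (4 , r) = decodeWith f (proj₁ (unpair r)) ⇒ decodeWith f (proj₂ (unpair r))
-- tag 1 (that is, ⊥ᶠ) and every code outside the image of encode
decodeNode f _       = ⊥ᶠ

decodeWith-encode : ∀ χ {f} → encode χ < f → decodeWith f (encode χ) ≡ χ
decodeWith-encode (atom p) (s≤s _) rewrite unpair-pair 0 p = refl
decodeWith-encode ⊥ᶠ       (s≤s _) rewrite unpair-pair 1 0 = refl
decodeWith-encode (a ∧ᶠ b) (s≤s h)
  rewrite unpair-pair 2 (pair (encode a) (encode b)) | unpair-pair (encode a) (encode b)
        | decodeWith-encode a (<-≤-trans (encode-<ˡ 1 (encode a) (encode b)) h)
        | decodeWith-encode b (<-≤-trans (encode-<ʳ 1 (encode a) (encode b)) h) = refl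
decodeWith-encode (a ∨ᶠ b) (s≤s h)
  rewrite unpair-pair 3 (pair (encode a) (encode b)) | unpair-pair (encode a) (encode b)
        | decodeWith-encode a (<-≤-trans (encode-<ˡ 2 (encode a) (encode b)) h)
        | decodeWith-encode b (<-≤-trans (encode-<ʳ 2 (encode a) (encode b)) h) = refl
decodeWith-encode (a ⇒ b)  (s≤s h)
  rewrite unpair-pair 4 (pair (encode a) (encode b)) | unpair-pair (encode a) (encode b)
        | decodeWith-encode a (<-≤-trans (encode-<ˡ 3 (encode a) (encode b)) h)
        | decodeWith-encode b (<-≤-trans (encode-<ʳ 3 (encode a) (encode b)) h) = refl

-- Codes of subformulas are strictly smaller, so fuel n suffices for code n.
decode : ℕ → Formula
decode n = decodeWith (suc n) n

decode-encode : ∀ χ → decode (encode χ) ≡ χ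
decode-encode χ = decodeWith-encode χ ≤-refl

atomBound : Formula → ℕ
atomBound (atom p) = suc p
atomBound ⊥ᶠ       = 0
atomBound (a ∧ᶠ b) = atomBound a ⊔ atomBound b
atomBound (a ∨ᶠ b) = atomBound a ⊔ atomBound b
atomBound (a ⇒ b)  = atomBound a ⊔ atomBound b

_⇛_ : List Formula → Formula → Formula
Γ ⇛ φ = foldr _⇒_ φ Γ

-- Used with m above every atom of Γ and φ, so that the atoms m + encode χ are fresh.
module Flattening (m : ℕ) where

  Small : Formula → Set
  Small χ = atomBound χ ≤ m

  smallˡ : ∀ a b → atomBound a ⊔ atomBound b ≤ m → Small a
  smallˡ a b = m⊔n≤o⇒m≤o (atomBound a) (atomBound b)

  smallʳ : ∀ a b → atomBound a ⊔ atomBound b ≤ m → Small b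
  smallʳ a b = m⊔n≤o⇒n≤o (atomBound a) (atomBound b)

  small-⇛ : ∀ Γ {φ} → Small (Γ ⇛ φ) → All Small Γ × Small φ
  small-⇛ []      small = [] , small
  small-⇛ (γ ∷ Γ) small with small-⇛ Γ (smallʳ γ (Γ ⇛ _) small)
  ... | smallΓ , smallφ = smallˡ γ (Γ ⇛ _) small ∷ smallΓ , smallφ

  ♭ : Formula → Atom
  ♭ (atom p) = p
  ♭ χ        = m + encode χ

  ♮ : Atom → Formula
  ♮ n with n <? m
  ... | yes _ = atom n
  ... | no  _ = decode (n ∸ m)

  ♮[m+e] : ∀ e → ♮ (m + e) ≡ decode e
  ♮[m+e] e with m + e <? m
  ... | yes m+e<m = ⊥-elim (m+n≮m m e m+e<m)
  ... | no  _     = cong decode (m+n∸m≡n m e)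

  ♮♭ : ∀ χ → Small χ → ♮ (♭ χ) ≡ χ
  ♮♭ (atom p) p<m with p <? m
  ... | yes _   = refl
  ... | no  p≮m = ⊥-elim (p≮m p<m)
  ♮♭ χ@⊥ᶠ       _ = trans (♮[m+e] (encode χ)) (decode-encode χ)
  ♮♭ χ@(_ ∧ᶠ _) _ = trans (♮[m+e] (encode χ)) (decode-encode χ)
  ♮♭ χ@(_ ∨ᶠ _) _ = trans (♮[m+e] (encode χ)) (decode-encode χ)
  ♮♭ χ@(_ ⇒ _)  _ = trans (♮[m+e] (encode χ)) (decode-encode χ)

  -- Sandqvist's base 𝒩: the natural deduction rules, read on flattening atoms.
  data 𝒩 : Rule → Set where
    ⊥ᴱ  : ∀ p → 𝒩 ((([] , ♭ ⊥ᶠ) ∷ []) ⟹ p)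
    ∧ᴵ  : ∀ a b → Small (a ∧ᶠ b) → 𝒩 ((([] , ♭ a) ∷ ([] , ♭ b) ∷ []) ⟹ ♭ (a ∧ᶠ b))
    ∧ᴱˡ : ∀ a b → Small (a ∧ᶠ b) → 𝒩 ((([] , ♭ (a ∧ᶠ b)) ∷ []) ⟹ ♭ a)
    ∧ᴱʳ : ∀ a b → Small (a ∧ᶠ b) → 𝒩 ((([] , ♭ (a ∧ᶠ b)) ∷ []) ⟹ ♭ b)
    ∨ᴵˡ : ∀ a b → Small (a ∨ᶠ b) → 𝒩 ((([] , ♭ a) ∷ []) ⟹ ♭ (a ∨ᶠ b))
    ∨ᴵʳ : ∀ a b → Small (a ∨ᶠ b) → 𝒩 ((([] , ♭ b) ∷ []) ⟹ ♭ (a ∨ᶠ b))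
    ∨ᴱ  : ∀ a b → Small (a ∨ᶠ b) → ∀ p →
          𝒩 ((([] , ♭ (a ∨ᶠ b)) ∷ (♭ a ∷ [] , p) ∷ (♭ b ∷ [] , p) ∷ []) ⟹ p)
    ⇒ᴵ  : ∀ a b → Small (a ⇒ b) → 𝒩 (((♭ a ∷ [] , ♭ b) ∷ []) ⟹ ♭ (a ⇒ b))
    ⇒ᴱ  : ∀ a b → Small (a ⇒ b) → 𝒩 ((([] , ♭ (a ⇒ b)) ∷ ([] , ♭ a) ∷ []) ⟹ ♭ b)

  reflect : ∀ χ → Small χ → ∀ {C} → 𝒩 ⊆ᴮ C → ⊩ C (atom (♭ χ)) → ⊩ C χ
  reify   : ∀ χ → Small χ → ∀ {C} → 𝒩 ⊆ᴮ C → ⊩ C χ → ⊩ C (atom (♭ χ))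
  hypothetical : ∀ a → Small a → ∀ {C p} → 𝒩 ⊆ᴮ C →
    (∀ D → C ⊆ᴮ D → ⊩ D a → ⊩ D (atom p)) → (♭ a ∷ []) ⊢[ C ] p

  reflect (atom p) _ _ s = s
  reflect ⊥ᶠ _ 𝒩⊆C s p = ⊩-rule₁ (𝒩⊆C _ (⊥ᴱ p)) s
  reflect (a ∧ᶠ b) small 𝒩⊆C s D C⊆D p k = k D ⊆ᴮ-refl
    (reflect a (smallˡ a b small) 𝒩⊆D (⊩-rule₁ (𝒩⊆D _ (∧ᴱˡ a b small)) (⊩-mono C⊆D s)))
    (reflect b (smallʳ a b small) 𝒩⊆D (⊩-rule₁ (𝒩⊆D _ (∧ᴱʳ a b small)) (⊩-mono C⊆D s)))
    where
    𝒩⊆D : 𝒩 ⊆ᴮ D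
    𝒩⊆D = ⊆ᴮ-trans 𝒩⊆C C⊆D
  reflect (a ∨ᶠ b) small 𝒩⊆C (lift d) D C⊆D p k₁ k₂ = lift (app (𝒩⊆D _ (∨ᴱ a b small p)) λ
    { (here refl)                 → ⊢-mono C⊆D d
    ; (there (here refl))         → hypothetical a (smallˡ a b small) 𝒩⊆D k₁
    ; (there (there (here refl))) → hypothetical b (smallʳ a b small) 𝒩⊆D k₂
    ; (there (there (there ()))) })
    where
    𝒩⊆D : 𝒩 ⊆ᴮ D
    𝒩⊆D = ⊆ᴮ-trans 𝒩⊆C C⊆D
  reflect (a ⇒ b) small 𝒩⊆C s D C⊆D sa = reflect b (smallʳ a b small) 𝒩⊆D
    (⊩-rule₂ (𝒩⊆D _ (⇒ᴱ a b small)) (⊩-mono C⊆D s) (reify a (smallˡ a b small) 𝒩⊆D sa))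
    where
    𝒩⊆D : 𝒩 ⊆ᴮ D
    𝒩⊆D = ⊆ᴮ-trans 𝒩⊆C C⊆D

  reify (atom p) _ _ s = s
  reify ⊥ᶠ _ _ s = s (♭ ⊥ᶠ)
  reify (a ∧ᶠ b) small 𝒩⊆C s = s _ ⊆ᴮ-refl (♭ (a ∧ᶠ b)) λ D C⊆D sa sb →
    let 𝒩⊆D = ⊆ᴮ-trans 𝒩⊆C C⊆D in
    ⊩-rule₂ (𝒩⊆D _ (∧ᴵ a b small)) (reify a (smallˡ a b small) 𝒩⊆D sa)
                                    (reify b (smallʳ a b small) 𝒩⊆D sb)
  reify (a ∨ᶠ b) small 𝒩⊆C s = s _ ⊆ᴮ-refl (♭ (a ∨ᶠ b))
    (λ D C⊆D sa → let 𝒩⊆D = ⊆ᴮ-trans 𝒩⊆C C⊆D in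
      ⊩-rule₁ (𝒩⊆D _ (∨ᴵˡ a b small)) (reify a (smallˡ a b small) 𝒩⊆D sa))
    (λ D C⊆D sb → let 𝒩⊆D = ⊆ᴮ-trans 𝒩⊆C C⊆D in
      ⊩-rule₁ (𝒩⊆D _ (∨ᴵʳ a b small)) (reify b (smallʳ a b small) 𝒩⊆D sb))
  reify (a ⇒ b) small 𝒩⊆C s = lift (app (𝒩⊆C _ (⇒ᴵ a b small)) λ
    { (here refl) → hypothetical a (smallˡ a b small) 𝒩⊆C λ D C⊆D sa →
                      reify b (smallʳ a b small) (⊆ᴮ-trans 𝒩⊆C C⊆D) (s D C⊆D sa)
    ; (there ()) })

  -- Assume a by adding its atom as an axiom, then turn the axiom into a hypothesis.
  hypothetical a small {C} 𝒩⊆C k = axioms⇒hypotheses (λ ()) ⊆-refl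
    (lower (k (C ∪ax (♭ a ∷ [])) ∪ax-⊇
                (reflect a small (⊆ᴮ-trans 𝒩⊆C ∪ax-⊇) (lift (axiom (here refl))))))

  module Decoding (Γ : List Formula) (smallΓ : All Small Γ) where

    𝒩Γ : Base
    𝒩Γ = 𝒩 ∪ax map ♭ Γ

    record _≼_ (S : List Atom) (Δ : List Formula) : Set where
      field
        assumptions : Γ ⊆ Δ
        hypotheses  : ∀ {s} → s ∈ S → ♮ s ∈ Δ
    open _≼_

    ≼-++ : ∀ {S Δ} Q → S ≼ Δ → (S ++ Q) ≼ (map ♮ Q ++ Δ)
    ≼-++ Q S≼Δ .assumptions γ∈Γ = ∈-++⁺ʳ (map ♮ Q) (assumptions S≼Δ γ∈Γ)
    ≼-++ {S} Q S≼Δ .hypotheses s∈S++Q with ∈-++⁻ S s∈S++Q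
    ... | inj₁ s∈S = ∈-++⁺ʳ (map ♮ Q) (hypotheses S≼Δ s∈S)
    ... | inj₂ s∈Q = ∈-++⁺ˡ (∈-map⁺ ♮ s∈Q)

    ♮♭⁺ : ∀ {Δ} χ → Small χ → Δ ⊢ χ → Δ ⊢ ♮ (♭ χ)
    ♮♭⁺ {Δ} χ small = subst (Δ ⊢_) (sym (♮♭ χ small))

    ♮♭⁻ : ∀ {Δ} χ → Small χ → Δ ⊢ ♮ (♭ χ) → Δ ⊢ χ
    ♮♭⁻ {Δ} χ small = subst (Δ ⊢_) (♮♭ χ small)

    ♮♭-hyp : ∀ {Δ ψ} χ → Small χ → (♮ (♭ χ) ∷ Δ) ⊢ ψ → (χ ∷ Δ) ⊢ ψ
    ♮♭-hyp {Δ} {ψ} χ small = subst (λ θ → (θ ∷ Δ) ⊢ ψ) (♮♭ χ small)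

    ♮⊢ : ∀ {S Δ q} → S ⊢[ 𝒩Γ ] q → S ≼ Δ → Δ ⊢ ♮ q
    ♮⊢ (ref q∈S) S≼Δ = hyp (hypotheses S≼Δ q∈S)
    ♮⊢ (app (inj₂ (ax s∈♭Γ)) _) S≼Δ with ∈-map⁻ ♭ s∈♭Γ
    ... | γ , γ∈Γ , refl = ♮♭⁺ γ (All.lookup smallΓ γ∈Γ) (hyp (assumptions S≼Δ γ∈Γ))
    ♮⊢ (app (inj₁ (⊥ᴱ p)) ds) S≼Δ =
      ⊥E (♮♭⁻ ⊥ᶠ z≤n (♮⊢ (ds (here refl)) (≼-++ [] S≼Δ)))
    ♮⊢ (app (inj₁ (∧ᴵ a b small)) ds) S≼Δ = ♮♭⁺ (a ∧ᶠ b) small (∧I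
      (♮♭⁻ a (smallˡ a b small) (♮⊢ (ds (here refl)) (≼-++ [] S≼Δ)))
      (♮♭⁻ b (smallʳ a b small) (♮⊢ (ds (there (here refl))) (≼-++ [] S≼Δ))))
    ♮⊢ (app (inj₁ (∧ᴱˡ a b small)) ds) S≼Δ = ♮♭⁺ a (smallˡ a b small)
      (∧E₁ (♮♭⁻ (a ∧ᶠ b) small (♮⊢ (ds (here refl)) (≼-++ [] S≼Δ))))
    ♮⊢ (app (inj₁ (∧ᴱʳ a b small)) ds) S≼Δ = ♮♭⁺ b (smallʳ a b small)
      (∧E₂ (♮♭⁻ (a ∧ᶠ b) small (♮⊢ (ds (here refl)) (≼-++ [] S≼Δ))))
    ♮⊢ (app (inj₁ (∨ᴵˡ a b small)) ds) S≼Δ = ♮♭⁺ (a ∨ᶠ b) small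
      (∨I₁ (♮♭⁻ a (smallˡ a b small) (♮⊢ (ds (here refl)) (≼-++ [] S≼Δ))))
    ♮⊢ (app (inj₁ (∨ᴵʳ a b small)) ds) S≼Δ = ♮♭⁺ (a ∨ᶠ b) small
      (∨I₂ (♮♭⁻ b (smallʳ a b small) (♮⊢ (ds (here refl)) (≼-++ [] S≼Δ))))
    ♮⊢ (app (inj₁ (∨ᴱ a b small p)) ds) S≼Δ = ∨E
      (♮♭⁻ (a ∨ᶠ b) small (♮⊢ (ds (here refl)) (≼-++ [] S≼Δ)))
      (♮♭-hyp a (smallˡ a b small) (♮⊢ (ds (there (here refl))) (≼-++ (♭ a ∷ []) S≼Δ)))
      (♮♭-hyp b (smallʳ a b small) (♮⊢ (ds (there (there (here refl)))) (≼-++ (♭ b ∷ []) S≼Δ)))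
    ♮⊢ (app (inj₁ (⇒ᴵ a b small)) ds) S≼Δ = ♮♭⁺ (a ⇒ b) small
      (⇒I (♮♭-hyp a (smallˡ a b small) (♮♭⁻ b (smallʳ a b small)
        (♮⊢ (ds (here refl)) (≼-++ (♭ a ∷ []) S≼Δ)))))
    ♮⊢ (app (inj₁ (⇒ᴱ a b small)) ds) S≼Δ = ♮♭⁺ b (smallʳ a b small) (⇒E
      (♮♭⁻ (a ⇒ b) small (♮⊢ (ds (here refl)) (≼-++ [] S≼Δ)))
      (♮♭⁻ a (smallˡ a b small) (♮⊢ (ds (there (here refl))) (≼-++ [] S≼Δ))))

    ♮⊢₀ : ∀ {q} → [] ⊢[ 𝒩Γ ] q → Γ ⊢ ♮ q
    ♮⊢₀ d = ♮⊢ d record { assumptions = ⊆-refl ; hypotheses = λ () }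

    𝒩Γ⊩Γ : All (⊩ 𝒩Γ) Γ
    𝒩Γ⊩Γ = All.tabulate λ {γ} γ∈Γ →
      reflect γ (All.lookup smallΓ γ∈Γ) ∪ax-⊇ (lift (axiom (∈-map⁺ ♭ γ∈Γ)))

completeness : ∀ Γ φ → Γ ⊩* φ → Γ ⊢ φ
completeness Γ φ Γ⊩φ = ♮♭⁻ φ smallφ (♮⊢₀ (lower (reify φ smallφ ∪ax-⊇ ⊩φ)))
  where
  open Flattening (atomBound (Γ ⇛ φ))
  smallΓφ : All Small Γ × Small φ
  smallΓφ = small-⇛ Γ ≤-refl
  smallφ : Small φ
  smallφ = proj₂ smallΓφ
  open Decoding Γ (proj₁ smallΓφ)
  ⊩φ : ⊩ 𝒩Γ φ
  ⊩φ = ⊩[]-apply Γ (Γ⊩φ 𝒩) ∪ax-⊇ 𝒩Γ⊩Γ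

theorem2 : (Γ : List Formula) (φ : Formula) →
    ((Γ ⊩* φ → Γ ⊢ φ) × (Γ ⊢ φ → Γ ⊩* φ))
theorem2 Γ φ = completeness Γ φ , soundness Γ φ
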